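{- Let $a$ be a complex number (in particular, any integer) and $n\ge1$ an integer. Then $$\det_{0\le i,j\le n-1}\left(\binom{2i+2j+a}{i}-\binom{2i+2j+a}{i-1}\right)=2^{\binom n2}.$$
   Context: For a complex number $N$ and an integer $k$, the binomial coefficient is $\binom{N}{k}=\frac{N(N-1)\cdots(N-k+1)}{k!}$ if $k\ge0$ and $\binom Nk=0$ if $k<0$. -}

module Defs where

open import Level using (_⊔_)
open import Algebra.Bundles using (CommutativeRing)
open import Data.Nat as ℕ using (ℕ; zero; suc)
open import Data.Integer as ℤ using (ℤ; +_; -[1+_])
open import Data.Fin using (Fin; zero; suc; punchIn)

ringℕ : ∀ {c ℓ} (R : CommutativeRing c ℓ) → ℕ → CommutativeRing.Carrier R
ringℕ R zero    = CommutativeRing.0# R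
ringℕ R (suc m) = CommutativeRing._+_ R (CommutativeRing.1# R) (ringℕ R m)

-- A commutative ℚ-algebra: a commutative ring in which every positive
-- integer m+1 has a (chosen) multiplicative inverse  inv m.
-- ℂ (and any field of characteristic 0) is an instance.
record QAlgebra (c ℓ : Level.Level) : Set (Level.suc (c ⊔ ℓ)) where
  field
    cring       : CommutativeRing c ℓ
    inv         : ℕ → CommutativeRing.Carrier cring
    inv-correct : ∀ m → CommutativeRing._≈_ cring
                    (CommutativeRing._*_ cring (ringℕ cring (ℕ.suc m)) (inv m))
                    (CommutativeRing.1# cring)
  open CommutativeRing cring public
  fromℕ : ℕ → Carrier
  fromℕ = ringℕ cring

module _ {c ℓ} (A : QAlgebra c ℓ) where
  open QAlgebra A using (Carrier; _+_; _*_; _-_; -_; 0#; 1#; fromℕ; inv)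

  falling : Carrier → ℕ → Carrier
  falling N zero    = 1#
  falling N (suc k) = falling N k * (N - fromℕ k)

  invFact : ℕ → Carrier
  invFact zero    = 1#
  invFact (suc k) = invFact k * inv k

  binom : Carrier → ℤ → Carrier
  binom N (+ k)     = falling N k * invFact k
  binom N -[1+ _ ]  = 0#

  sumFin : (n : ℕ) → (Fin n → Carrier) → Carrier
  sumFin zero    f = 0#
  sumFin (suc n) f = f zero + sumFin n (λ i → f (suc i))

  sign : ℕ → Carrier
  sign zero    = 1#
  sign (suc j) = - sign j

  det : (n : ℕ) → (Fin n → Fin n → Carrier) → Carrier
  det zero    M = 1#
  det (suc n) M =
    sumFin (suc n) (λ j → sign (Data.Fin.toℕ j) * M zero j
                          * det n (λ i k → M (suc i) (punchIn j k)))

  entry : Carrier → ℕ → ℕ → Carrier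
  entry a i j =
    binom (fromℕ (2 ℕ.* i ℕ.+ 2 ℕ.* j) + a) (+ i)
      - binom (fromℕ (2 ℕ.* i ℕ.+ 2 ℕ.* j) + a) (+ i ℤ.- + 1)

-- Write the (i, j) entry as E₀(a + 2j, i), where E₀(N, i) = C(N+2i, i) − C(N+2i, i−1).
-- Its first row is constantly 1, so subtracting from every column its left neighbour and
-- expanding along the first row leaves the determinant of the matrix of column differences.
-- By Pascal's rule these differences have the same shape again:
-- E_k(N+2, i+1) − E_k(N, i+1) = E_{k+1}(N, i), where E_{k+1}(N, i) = E_k(N+3, i) + E_k(N+2, i),
-- and the first row of E_k is the constant E_k(N, 0) = 2^k. Hence the k-th reduction step
-- contributes a factor 2^k, and the determinant is 2^(0 + 1 + ⋯ + (n−1)) = 2^(n choose 2).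
module Submission where

open import Defs
open import Data.Nat using (ℕ; _≤_; _^_)
open import Data.Nat.Combinatorics using (_C_; nC1≡n; nCk+nC[k+1]≡[n+1]C[k+1])
open import Data.Fin using (Fin; zero; suc; toℕ; punchIn; punchOut; fromℕ<; _≟_)

open import Algebra.Bundles using (CommutativeRing)
open import Algebra.Solver.Ring.AlmostCommutativeRing using (fromCommutativeRing; _-Raw-AlmostCommutative⟶_)
open import Data.Fin.Properties
  using (punchInᵢ≢i; punchIn-injective; punchIn-punchOut; toℕ-injective; toℕ≤pred[n]; toℕ<n; toℕ-fromℕ<)
open import Data.Integer as ℤ using (ℤ; +_; -[1+_])
import Data.Integer.Properties as ℤP
open import Data.Maybe using (Maybe; just; nothing)
open import Data.Nat as ℕ using (zero; suc)
import Data.Nat.Properties as ℕP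
open import Data.Vec.Functional using (updateAt)
open import Data.Vec.Functional.Properties using (updateAt-updates; updateAt-minimal)
open import Function using (_∘_)
open import Relation.Binary.Definitions using (tri<; tri≈; tri>)
open import Relation.Binary.PropositionalEquality as ≡ using (_≡_; _≢_)
open import Relation.Nullary using (yes; no; contradiction)

-- The image of ℤ in a commutative ring, so that the ring solver can work
-- with integer coefficients (and hence cancel x - x).
module IntegerCoefficients {c ℓ} (R : CommutativeRing c ℓ) where
  open CommutativeRing R
  open import Algebra.Properties.Ring ring
    using (-‿involutive; -‿distribˡ-*; -‿distribʳ-*; -0#≈0#; -‿+-comm)
  open import Relation.Binary.Reasoning.Setoid setoid

  ringℕ-+ : ∀ m n → ringℕ R (m ℕ.+ n) ≈ ringℕ R m + ringℕ R n
  ringℕ-+ zero    n = sym (+-identityˡ _)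
  ringℕ-+ (suc m) n = trans (+-congˡ (ringℕ-+ m n)) (sym (+-assoc _ _ _))

  ringℕ-* : ∀ m n → ringℕ R (m ℕ.* n) ≈ ringℕ R m * ringℕ R n
  ringℕ-* zero    n = sym (zeroˡ _)
  ringℕ-* (suc m) n = begin
    ringℕ R (n ℕ.+ m ℕ.* n)                 ≈⟨ trans (ringℕ-+ n _) (+-congˡ (ringℕ-* m n)) ⟩
    ringℕ R n + ringℕ R m * ringℕ R n       ≈⟨ +-congʳ (sym (*-identityˡ _)) ⟩
    1# * ringℕ R n + ringℕ R m * ringℕ R n  ≈⟨ sym (distribʳ _ _ _) ⟩
    (1# + ringℕ R m) * ringℕ R n            ∎

  ringℤ : ℤ → Carrier
  ringℤ (+ n)    = ringℕ R n
  ringℤ -[1+ n ] = - ringℕ R (suc n)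

  ringℤ-neg : ∀ i → ringℤ (ℤ.- i) ≈ - ringℤ i
  ringℤ-neg (+ zero)  = sym -0#≈0#
  ringℤ-neg (+ suc n) = refl
  ringℤ-neg -[1+ n ]  = sym (-‿involutive _)

  ringℤ-⊖ : ∀ m n → ringℤ (m ℤ.⊖ n) ≈ ringℕ R m - ringℕ R n
  ringℤ-⊖ m       zero    = sym (trans (+-congˡ -0#≈0#) (+-identityʳ _))
  ringℤ-⊖ zero    (suc n) = sym (+-identityˡ _)
  ringℤ-⊖ (suc m) (suc n) = begin
    ringℤ (suc m ℤ.⊖ suc n)              ≡⟨ ≡.cong ringℤ (ℤP.[1+m]⊖[1+n]≡m⊖n m n) ⟩
    ringℤ (m ℤ.⊖ n)                      ≈⟨ ringℤ-⊖ m n ⟩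
    x - y                                ≈⟨ sym (+-identityˡ _) ⟩
    0# + (x - y)                         ≈⟨ +-congʳ (sym (-‿inverseʳ 1#)) ⟩
    (1# - 1#) + (x - y)                  ≈⟨ +-assoc _ _ _ ⟩
    1# + (- 1# + (x - y))                ≈⟨ +-congˡ (sym (+-assoc _ _ _)) ⟩
    1# + ((- 1# + x) - y)                ≈⟨ +-congˡ (+-congʳ (+-comm _ _)) ⟩
    1# + ((x - 1#) - y)                  ≈⟨ +-congˡ (+-assoc _ _ _) ⟩
    1# + (x + (- 1# - y))                ≈⟨ sym (+-assoc _ _ _) ⟩
    (1# + x) + (- 1# - y)                ≈⟨ +-congˡ (-‿+-comm 1# y) ⟩
    (1# + x) - (1# + y)                  ∎
    where x = ringℕ R m; y = ringℕ R n

  ringℤ-+ : ∀ i j → ringℤ (i ℤ.+ j) ≈ ringℤ i + ringℤ j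
  ringℤ-+ (+ m)    (+ n)    = ringℕ-+ m n
  ringℤ-+ (+ m)    -[1+ n ] = ringℤ-⊖ m (suc n)
  ringℤ-+ -[1+ m ] (+ n)    = trans (ringℤ-⊖ n (suc m)) (+-comm _ _)
  ringℤ-+ -[1+ m ] -[1+ n ] = begin
    - (1# + ringℕ R (suc (m ℕ.+ n)))     ≈⟨ -‿cong (+-congˡ (ringℕ-+ (suc m) n)) ⟩
    - (1# + (x + ringℕ R n))             ≈⟨ -‿cong (sym (+-assoc _ _ _)) ⟩
    - ((1# + x) + ringℕ R n)             ≈⟨ -‿cong (+-congʳ (+-comm _ _)) ⟩
    - ((x + 1#) + ringℕ R n)             ≈⟨ -‿cong (+-assoc _ _ _) ⟩
    - (x + ringℕ R (suc n))              ≈⟨ sym (-‿+-comm _ _) ⟩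
    - x - ringℕ R (suc n)                ∎
    where x = ringℕ R (suc m)

  ringℤ-*-+ : ∀ m n → ringℤ (+ m ℤ.* + n) ≈ ringℕ R m * ringℕ R n
  ringℤ-*-+ m n rewrite ≡.sym (ℤP.pos-* m n) = ringℕ-* m n

  ringℤ-* : ∀ i j → ringℤ (i ℤ.* j) ≈ ringℤ i * ringℤ j
  ringℤ-* (+ m)    (+ n)    = ringℤ-*-+ m n
  ringℤ-* (+ m)    -[1+ n ] = begin
    ringℤ (+ m ℤ.* -[1+ n ])            ≡⟨ ≡.cong ringℤ (≡.sym (ℤP.neg-distribʳ-* (+ m) (+ suc n))) ⟩
    ringℤ (ℤ.- (+ m ℤ.* + suc n))        ≈⟨ trans (ringℤ-neg (+ m ℤ.* + suc n)) (-‿cong (ringℤ-*-+ m (suc n))) ⟩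
    - (ringℕ R m * ringℕ R (suc n))      ≈⟨ -‿distribʳ-* _ _ ⟩
    ringℕ R m * - ringℕ R (suc n)        ∎
  ringℤ-* -[1+ m ] (+ n)    = begin
    ringℤ (-[1+ m ] ℤ.* + n)            ≡⟨ ≡.cong ringℤ (≡.sym (ℤP.neg-distribˡ-* (+ suc m) (+ n))) ⟩
    ringℤ (ℤ.- (+ suc m ℤ.* + n))        ≈⟨ trans (ringℤ-neg (+ suc m ℤ.* + n)) (-‿cong (ringℤ-*-+ (suc m) n)) ⟩
    - (ringℕ R (suc m) * ringℕ R n)      ≈⟨ -‿distribˡ-* _ _ ⟩
    - ringℕ R (suc m) * ringℕ R n        ∎
  ringℤ-* -[1+ m ] -[1+ n ] = begin
    ringℤ (+ suc m ℤ.* + suc n)          ≈⟨ ringℤ-*-+ (suc m) (suc n) ⟩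
    x * y                                ≈⟨ sym (-‿involutive _) ⟩
    - - (x * y)                          ≈⟨ -‿cong (-‿distribˡ-* _ _) ⟩
    - (- x * y)                          ≈⟨ -‿distribʳ-* _ _ ⟩
    - x * - y                            ∎
    where x = ringℕ R (suc m); y = ringℕ R (suc n)

  ringℤ-homomorphism : ℤ.+-*-rawRing -Raw-AlmostCommutative⟶ fromCommutativeRing R
  ringℤ-homomorphism = record
    { ⟦_⟧ = ringℤ ; +-homo = ringℤ-+ ; *-homo = ringℤ-* ; -‿homo = ringℤ-neg
    ; 0-homo = refl ; 1-homo = +-identityʳ 1# }

  ringℤ-≟ : ∀ i j → Maybe (ringℤ i ≈ ringℤ j)
  ringℤ-≟ i j with i ℤ.≟ j
  ... | yes ≡.refl = just refl
  ... | no _       = nothing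

  open import Algebra.Solver.Ring ℤ.+-*-rawRing (fromCommutativeRing R) ringℤ-homomorphism ringℤ-≟ public

toℕ-punchIn-< : ∀ {n} (j : Fin (suc n)) (k : Fin n) → toℕ k ℕ.< toℕ j → toℕ (punchIn j k) ≡ toℕ k
toℕ-punchIn-< (suc j) zero    _          = ≡.refl
toℕ-punchIn-< (suc j) (suc k) (ℕ.s≤s k<j) = ≡.cong suc (toℕ-punchIn-< j k k<j)

toℕ-punchIn-≥ : ∀ {n} (j : Fin (suc n)) (k : Fin n) → toℕ j ℕ.≤ toℕ k → toℕ (punchIn j k) ≡ suc (toℕ k)
toℕ-punchIn-≥ zero    k       _          = ≡.refl
toℕ-punchIn-≥ (suc j) (suc k) (ℕ.s≤s j≤k) = ≡.cong suc (toℕ-punchIn-≥ j k j≤k)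

module Determinants {c ℓ} (A : QAlgebra c ℓ) where
  open QAlgebra A hiding (zero)
  open import Relation.Binary.Reasoning.Setoid setoid
  open IntegerCoefficients cring using (solve; _:+_; _:*_; _:-_; :-_; _:=_; con)

  Matrix : ℕ → Set c
  Matrix n = Fin n → Fin n → Carrier

  minor : ∀ {n} → Matrix (suc n) → Fin (suc n) → Matrix n
  minor M j i k = M (suc i) (punchIn j k)

  laplaceTerm : ∀ {n} → Matrix (suc n) → Fin (suc n) → Carrier
  laplaceTerm {n} M j = sign A (toℕ j) * M zero j * det A n (minor M j)

  AdjacentEqualColumns : ∀ {n} → Matrix n → ℕ → Set ℓ
  AdjacentEqualColumns M t = ∀ i j k → toℕ j ≡ t → toℕ k ≡ suc t → M i j ≈ M i k

  sumFin-cong : ∀ n {f g : Fin n → Carrier} → (∀ i → f i ≈ g i) → sumFin A n f ≈ sumFin A n g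
  sumFin-cong zero    f≈g = refl
  sumFin-cong (suc n) f≈g = +-cong (f≈g zero) (sumFin-cong n (f≈g ∘ suc))

  sumFin-≈0 : ∀ n {f : Fin n → Carrier} → (∀ i → f i ≈ 0#) → sumFin A n f ≈ 0#
  sumFin-≈0 zero    f≈0 = refl
  sumFin-≈0 (suc n) f≈0 = trans (+-cong (f≈0 zero) (sumFin-≈0 n (f≈0 ∘ suc))) (+-identityʳ 0#)

  sumFin-+ : ∀ n (f g : Fin n → Carrier) → sumFin A n (λ j → f j + g j) ≈ sumFin A n f + sumFin A n g
  sumFin-+ zero    f g = sym (+-identityʳ 0#)
  sumFin-+ (suc n) f g = trans (+-congˡ (sumFin-+ n (f ∘ suc) (g ∘ suc)))
    (solve 4 (λ x y u v → (x :+ y) :+ (u :+ v) := (x :+ u) :+ (y :+ v)) refl (f zero) (g zero) _ _)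

  sumFin-adjacentPair : ∀ n {f : Fin n → Carrier} t → suc t ℕ.< n →
    (∀ j → toℕ j ≢ t → toℕ j ≢ suc t → f j ≈ 0#) →
    (∀ j k → toℕ j ≡ t → toℕ k ≡ suc t → f j + f k ≈ 0#) → sumFin A n f ≈ 0#
  sumFin-adjacentPair (suc (suc n)) {f} zero _ others pair = begin
    f zero + (f (suc zero) + sumFin A n (λ j → f (suc (suc j))))
      ≈⟨ +-congˡ (+-congˡ (sumFin-≈0 n (λ j → others (suc (suc j)) (λ ()) (λ ())))) ⟩
    f zero + (f (suc zero) + 0#)
      ≈⟨ trans (+-congˡ (+-identityʳ _)) (pair zero (suc zero) ≡.refl ≡.refl) ⟩
    0#                                                    ∎
  sumFin-adjacentPair (suc n) (suc t) (ℕ.s≤s lt) others pair =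
    trans (+-cong (others zero (λ ()) (λ ()))
                  (sumFin-adjacentPair n t lt
                    (λ j j≢t j≢1+t → others (suc j) (j≢t ∘ ℕP.suc-injective) (j≢1+t ∘ ℕP.suc-injective))
                    (λ j k j≡t k≡1+t → pair (suc j) (suc k) (≡.cong suc j≡t) (≡.cong suc k≡1+t))))
          (+-identityʳ 0#)

  det-cong : ∀ n {M N : Matrix n} → (∀ i j → M i j ≈ N i j) → det A n M ≈ det A n N
  det-cong zero    M≈N = refl
  det-cong (suc n) M≈N = sumFin-cong (suc n) (λ j →
    *-cong (*-congˡ {sign A (toℕ j)} (M≈N zero j)) (det-cong n (λ i k → M≈N (suc i) (punchIn j k))))

  det-additiveInColumn : ∀ n (col : Fin n) {M P Q : Matrix n} →
    (∀ i → M i col ≈ P i col + Q i col) →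
    (∀ i j → j ≢ col → M i j ≈ P i j) → (∀ i j → j ≢ col → Q i j ≈ P i j) →
    det A n M ≈ det A n P + det A n Q
  det-additiveInColumn (suc n) col {M} {P} {Q} M≈P+Q M≈P Q≈P =
    trans (sumFin-cong (suc n) split) (sumFin-+ (suc n) (laplaceTerm P) (laplaceTerm Q))
    where
    split : ∀ j → laplaceTerm M j ≈ laplaceTerm P j + laplaceTerm Q j
    split j with j ≟ col
    ... | yes ≡.refl = begin
      s * M zero j * det A n (minor M j)             ≈⟨ *-cong (*-congˡ (M≈P+Q zero)) (det-cong n minorM≈P) ⟩
      s * (P zero j + Q zero j) * det A n (minor P j) ≈⟨ trans (*-congʳ (distribˡ s _ _)) (distribʳ _ _ _) ⟩
      s * P zero j * det A n (minor P j) + s * Q zero j * det A n (minor P j)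
        ≈⟨ +-congˡ (*-congˡ (det-cong n (λ i k → sym (Q≈P (suc i) (punchIn j k) (punchInᵢ≢i j k))))) ⟩
      laplaceTerm P j + laplaceTerm Q j              ∎
      where
      s = sign A (toℕ j)
      minorM≈P : ∀ i k → minor M j i k ≈ minor P j i k
      minorM≈P i k = M≈P (suc i) (punchIn j k) (punchInᵢ≢i j k)
    ... | no j≢col = begin
      s * M zero j * det A n (minor M j)            ≈⟨ *-cong (*-congˡ (M≈P zero j j≢col)) minor-additive ⟩
      s * P zero j * (det A n (minor P j) + det A n (minor Q j)) ≈⟨ distribˡ _ _ _ ⟩
      laplaceTerm P j + s * P zero j * det A n (minor Q j)
        ≈⟨ +-congˡ (*-congʳ (*-congˡ (sym (Q≈P zero j j≢col)))) ⟩
      laplaceTerm P j + laplaceTerm Q j             ∎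
      where
      s = sign A (toℕ j)
      col′ = punchOut j≢col
      avoids : ∀ k → k ≢ col′ → punchIn j k ≢ col
      avoids k k≢col′ eq = k≢col′ (punchIn-injective j k col′ (≡.trans eq (≡.sym (punchIn-punchOut j≢col))))
      minor-additive : det A n (minor M j) ≈ det A n (minor P j) + det A n (minor Q j)
      minor-additive = det-additiveInColumn n col′
        (λ i → ≡.subst (λ z → M (suc i) z ≈ P (suc i) z + Q (suc i) z)
                         (≡.sym (punchIn-punchOut j≢col)) (M≈P+Q (suc i)))
        (λ i k k≢col′ → M≈P (suc i) (punchIn j k) (avoids k k≢col′))
        (λ i k k≢col′ → Q≈P (suc i) (punchIn j k) (avoids k k≢col′))

  minor-adjacentEqualColumns-left : ∀ {n} (M : Matrix (suc n)) j t →
    AdjacentEqualColumns M (suc t) → toℕ j ℕ.≤ t → AdjacentEqualColumns (minor M j) t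
  minor-adjacentEqualColumns-left M j t equal j≤t i k k′ k≡t k′≡1+t = equal (suc i) _ _
    (≡.trans (toℕ-punchIn-≥ j k (≡.subst (toℕ j ℕ.≤_) (≡.sym k≡t) j≤t)) (≡.cong suc k≡t))
    (≡.trans (toℕ-punchIn-≥ j k′ (≡.subst (toℕ j ℕ.≤_) (≡.sym k′≡1+t) (ℕP.m≤n⇒m≤1+n j≤t))) (≡.cong suc k′≡1+t))

  minor-adjacentEqualColumns-right : ∀ {n} (M : Matrix (suc n)) j t →
    AdjacentEqualColumns M t → suc t ℕ.< toℕ j → AdjacentEqualColumns (minor M j) t
  minor-adjacentEqualColumns-right M j t equal 1+t<j i k k′ k≡t k′≡1+t = equal (suc i) _ _
    (≡.trans (toℕ-punchIn-< j k (≡.subst (ℕ._< toℕ j) (≡.sym k≡t) (ℕP.<-trans (ℕP.n<1+n t) 1+t<j))) k≡t)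
    (≡.trans (toℕ-punchIn-< j k′ (≡.subst (ℕ._< toℕ j) (≡.sym k′≡1+t) 1+t<j)) k′≡1+t)

  minor-adjacentEqualColumns : ∀ {n} (M : Matrix (suc n)) t j j′ →
    AdjacentEqualColumns M t → toℕ j ≡ t → toℕ j′ ≡ suc t → ∀ i k → minor M j i k ≈ minor M j′ i k
  minor-adjacentEqualColumns M t j j′ equal j≡t j′≡1+t i k with ℕP.<-cmp (toℕ k) t
  ... | tri< k<t _ _ = reflexive (≡.cong (M (suc i)) (toℕ-injective (≡.trans
          (toℕ-punchIn-< j k (≡.subst (toℕ k ℕ.<_) (≡.sym j≡t) k<t))
          (≡.sym (toℕ-punchIn-< j′ k (≡.subst (toℕ k ℕ.<_) (≡.sym j′≡1+t) (ℕP.m<n⇒m<1+n k<t)))))))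
  ... | tri≈ _ k≡t _ = sym (equal (suc i) _ _
          (≡.trans (toℕ-punchIn-< j′ k (≡.subst (toℕ k ℕ.<_) (≡.sym j′≡1+t) (ℕ.s≤s (ℕP.≤-reflexive k≡t)))) k≡t)
          (≡.trans (toℕ-punchIn-≥ j k (ℕP.≤-reflexive (≡.trans j≡t (≡.sym k≡t)))) (≡.cong suc k≡t)))
  ... | tri> _ _ t<k = reflexive (≡.cong (M (suc i)) (toℕ-injective (≡.trans
          (toℕ-punchIn-≥ j k (≡.subst (ℕ._≤ toℕ k) (≡.sym j≡t) (ℕP.<⇒≤ t<k)))
          (≡.sym (toℕ-punchIn-≥ j′ k (≡.subst (ℕ._≤ toℕ k) (≡.sym j′≡1+t) t<k))))))

  det-adjacentEqualColumns : ∀ n (M : Matrix n) t → suc t ℕ.< n → AdjacentEqualColumns M t → det A n M ≈ 0#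
  det-adjacentEqualColumns (suc n) M t 1+t<1+n equal = sumFin-adjacentPair (suc n) t 1+t<1+n vanishes cancels
    where
    det-minor≈0-left : ∀ j t → AdjacentEqualColumns M t → suc t ℕ.< suc n → toℕ j ℕ.< t →
      det A n (minor M j) ≈ 0#
    det-minor≈0-left j (suc t) equal (ℕ.s≤s 2+t≤n) (ℕ.s≤s j≤t) =
      det-adjacentEqualColumns n (minor M j) t 2+t≤n (minor-adjacentEqualColumns-left M j t equal j≤t)

    vanishes : ∀ j → toℕ j ≢ t → toℕ j ≢ suc t → laplaceTerm M j ≈ 0#
    vanishes j j≢t j≢1+t = trans (*-congˡ det-minor≈0) (zeroʳ _)
      where
      det-minor≈0 : det A n (minor M j) ≈ 0#
      det-minor≈0 with ℕP.<-cmp (toℕ j) t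
      ... | tri< j<t _ _ = det-minor≈0-left j t equal 1+t<1+n j<t
      ... | tri≈ _ j≡t _ = contradiction j≡t j≢t
      ... | tri> _ _ t<j = det-adjacentEqualColumns n (minor M j) t
              (ℕP.<-≤-trans 1+t<j (toℕ≤pred[n] j)) (minor-adjacentEqualColumns-right M j t equal 1+t<j)
        where 1+t<j = ℕP.≤∧≢⇒< t<j (j≢1+t ∘ ≡.sym)

    cancels : ∀ j j′ → toℕ j ≡ t → toℕ j′ ≡ suc t → laplaceTerm M j + laplaceTerm M j′ ≈ 0#
    cancels j j′ j≡t j′≡1+t = begin
      s * x * d + laplaceTerm M j′
        ≈⟨ +-congˡ (*-cong (*-cong (reflexive sign-j′) (sym (equal zero j j′ j≡t j′≡1+t)))
                           (det-cong n (λ i k → sym (minor-adjacentEqualColumns M t j j′ equal j≡t j′≡1+t i k)))) ⟩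
      s * x * d + (- s) * x * d
        ≈⟨ solve 3 (λ s x d → s :* x :* d :+ (:- s) :* x :* d := con (+ 0)) refl s x d ⟩
      0# ∎
      where
      s = sign A (toℕ j); x = M zero j; d = det A n (minor M j)
      sign-j′ : sign A (toℕ j′) ≡ - s
      sign-j′ = ≡.trans (≡.cong (sign A) j′≡1+t) (≡.cong (λ m → - sign A m) (≡.sym j≡t))

  det-subtractAdjacentColumn : ∀ n {M M′ : Matrix n} t → suc t ℕ.< n →
    (∀ i j → toℕ j ≢ suc t → M′ i j ≈ M i j) →
    (∀ i j k → toℕ j ≡ t → toℕ k ≡ suc t → M′ i k ≈ M i k - M i j) →
    det A n M′ ≈ det A n M
  det-subtractAdjacentColumn n {M} {M′} t 1+t<n M′≈M M′≈M-M = begin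
    det A n M′                ≈⟨ sym (+-identityʳ _) ⟩
    det A n M′ + 0#           ≈⟨ +-congˡ (sym (det-adjacentEqualColumns n Q t 1+t<n Q-adjacentEqual)) ⟩
    det A n M′ + det A n Q    ≈⟨ sym (det-additiveInColumn n col M≈M′+Q M≈M′ Q≈M′) ⟩
    det A n M                 ∎
    where
    col col′ : Fin n
    col  = fromℕ< 1+t<n
    col′ = fromℕ< (ℕP.<-trans (ℕP.n<1+n t) 1+t<n)
    toℕ-col : toℕ col ≡ suc t
    toℕ-col = toℕ-fromℕ< 1+t<n
    toℕ-col′ : toℕ col′ ≡ t
    toℕ-col′ = toℕ-fromℕ< _
    Q : Matrix n
    Q i = updateAt (M i) col (λ _ → M i col′)
    ≢col : ∀ {j} → toℕ j ≢ suc t → j ≢ col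
    ≢col j≢1+t j≡col = j≢1+t (≡.trans (≡.cong toℕ j≡col) toℕ-col)
    M≈M′ : ∀ i j → j ≢ col → M i j ≈ M′ i j
    M≈M′ i j j≢col = sym (M′≈M i j (λ j≡1+t → j≢col (toℕ-injective (≡.trans j≡1+t (≡.sym toℕ-col)))))
    Q≈M′ : ∀ i j → j ≢ col → Q i j ≈ M′ i j
    Q≈M′ i j j≢col = trans (reflexive (updateAt-minimal j col (M i) j≢col)) (M≈M′ i j j≢col)
    M≈M′+Q : ∀ i → M i col ≈ M′ i col + Q i col
    M≈M′+Q i = begin
      M i col                         ≈⟨ solve 2 (λ x y → x := (x :- y) :+ y) refl (M i col) (M i col′) ⟩
      (M i col - M i col′) + M i col′ ≈⟨ +-cong (sym (M′≈M-M i col′ col toℕ-col′ toℕ-col))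
                                                (reflexive (≡.sym (updateAt-updates col (M i)))) ⟩
      M′ i col + Q i col              ∎
    Q-adjacentEqual : AdjacentEqualColumns Q t
    Q-adjacentEqual i j k j≡t k≡1+t = begin
      Q i j    ≡⟨ updateAt-minimal j col (M i) (≢col (λ j≡1+t → ℕP.1+n≢n (≡.trans (≡.sym j≡1+t) j≡t))) ⟩
      M i j    ≡⟨ ≡.cong (M i) (toℕ-injective (≡.trans j≡t (≡.sym toℕ-col′))) ⟩
      M i col′ ≡⟨ updateAt-updates col (M i) ⟨
      Q i col  ≡⟨ ≡.cong (Q i) (toℕ-injective (≡.trans toℕ-col (≡.sym k≡1+t))) ⟩
      Q i k    ∎

  matrixOf : ∀ n → (ℕ → ℕ → Carrier) → Matrix n
  matrixOf n f i j = f (toℕ i) (toℕ j)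

  differenceAbove : ℕ → (ℕ → Carrier) → ℕ → Carrier
  differenceAbove t       g zero    = g zero
  differenceAbove zero    g (suc j) = g (suc j) - g j
  differenceAbove (suc t) g (suc j) = differenceAbove t (g ∘ suc) j

  differenceAbove-≤ : ∀ t g j → j ℕ.≤ t → differenceAbove t g j ≡ g j
  differenceAbove-≤ t       g zero    _           = ≡.refl
  differenceAbove-≤ (suc t) g (suc j) (ℕ.s≤s j≤t) = differenceAbove-≤ t (g ∘ suc) j j≤t

  differenceAbove-suc : ∀ t g → differenceAbove t g (suc t) ≡ g (suc t) - g t
  differenceAbove-suc zero    g = ≡.refl
  differenceAbove-suc (suc t) g = differenceAbove-suc t (g ∘ suc)

  differenceAbove-≢ : ∀ t g j → j ≢ suc t → differenceAbove t g j ≡ differenceAbove (suc t) g j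
  differenceAbove-≢ t       g zero          _       = ≡.refl
  differenceAbove-≢ zero    g (suc zero)    j≢1     = contradiction ≡.refl j≢1
  differenceAbove-≢ zero    g (suc (suc j)) _       = ≡.refl
  differenceAbove-≢ (suc t) g (suc j)       j≢2+t   = differenceAbove-≢ t (g ∘ suc) j (j≢2+t ∘ ≡.cong suc)

  differencedAbove : ∀ n → ℕ → (ℕ → ℕ → Carrier) → Matrix n
  differencedAbove n t f = matrixOf n (λ i → differenceAbove t (f i))

  det-differencedAbove-suc : ∀ n f t → suc t ℕ.< n →
    det A n (differencedAbove n t f) ≈ det A n (differencedAbove n (suc t) f)
  det-differencedAbove-suc n f t 1+t<n = det-subtractAdjacentColumn n t 1+t<n
    (λ i j j≢1+t → reflexive (differenceAbove-≢ t (f (toℕ i)) (toℕ j) j≢1+t))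
    column
    where
    column : ∀ i j k → toℕ j ≡ t → toℕ k ≡ suc t →
      differencedAbove n t f i k ≈ differencedAbove n (suc t) f i k - differencedAbove n (suc t) f i j
    column i j k j≡t k≡1+t rewrite j≡t | k≡1+t = begin
      differenceAbove t g (suc t)
        ≡⟨ differenceAbove-suc t g ⟩
      g (suc t) - g t
        ≡⟨ ≡.cong₂ _-_ (differenceAbove-≤ (suc t) g (suc t) ℕP.≤-refl) (differenceAbove-≤ (suc t) g t (ℕP.n≤1+n t)) ⟨
      differenceAbove (suc t) g (suc t) - differenceAbove (suc t) g t ∎
      where g = f (toℕ i)

  det-differencedAbove : ∀ n f t → det A n (differencedAbove n t f) ≈ det A n (matrixOf n f)
  det-differencedAbove n f t = go n t (ℕP.m≤n⇒m≤1+n (ℕP.m≤m+n n t))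
    where
    go : ∀ d t → n ℕ.≤ suc (d ℕ.+ t) → det A n (differencedAbove n t f) ≈ det A n (matrixOf n f)
    go d t n≤1+d+t with suc t ℕ.<? n | d
    ... | yes 1+t<n | suc d′ = trans (det-differencedAbove-suc n f t 1+t<n)
                                 (go d′ (suc t) (≡.subst (λ m → n ℕ.≤ suc m) (≡.sym (ℕP.+-suc d′ t)) n≤1+d+t))
    ... | yes 1+t<n | zero   = contradiction 1+t<n (ℕP.≤⇒≯ n≤1+d+t)
    ... | no 1+t≮n  | _      = det-cong n (λ i j → reflexive (differenceAbove-≤ t (f (toℕ i)) (toℕ j)
                                 (ℕP.≤-pred (ℕP.≤-trans (toℕ<n j) (ℕP.≮⇒≥ 1+t≮n)))))

  det-constantFirstRow : ∀ n f r → (∀ j → f 0 j ≈ r) →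
    det A (suc n) (matrixOf (suc n) f) ≈ r * det A n (matrixOf n (λ i j → f (suc i) (suc j) - f (suc i) j))
  det-constantFirstRow n f r f₀≈r = begin
    det A (suc n) (matrixOf (suc n) f)           ≈⟨ det-differencedAbove (suc n) f 0 ⟨
    det A (suc n) (differencedAbove (suc n) 0 f) ≈⟨ +-cong (*-congʳ (*-congˡ (f₀≈r 0))) (sumFin-≈0 n differenced≈0) ⟩
    1# * r * det A n X + 0#                      ≈⟨ trans (+-identityʳ _) (*-congʳ (*-identityˡ r)) ⟩
    r * det A n X                                ∎
    where
    X = matrixOf n (λ i j → f (suc i) (suc j) - f (suc i) j)
    differenced≈0 : ∀ j → laplaceTerm (differencedAbove (suc n) 0 f) (suc j) ≈ 0#
    differenced≈0 j = begin
      _ * (f 0 (suc (toℕ j)) - f 0 (toℕ j)) * _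
        ≈⟨ *-congʳ (*-congˡ (trans (+-cong (f₀≈r _) (-‿cong (f₀≈r _))) (-‿inverseʳ r))) ⟩
      _ * 0# * _
        ≈⟨ trans (*-congʳ (zeroʳ _)) (zeroˡ _) ⟩
      0# ∎

suc-C-2 : ∀ n → suc n C 2 ≡ n ℕ.+ n C 2
suc-C-2 n = ≡.trans (≡.sym (nCk+nC[k+1]≡[n+1]C[k+1] n 1)) (≡.cong (ℕ._+ n C 2) (nC1≡n n))

exponent-suc : ∀ k n → k ℕ.+ (suc k ℕ.* n ℕ.+ n C 2) ≡ k ℕ.* suc n ℕ.+ suc n C 2
exponent-suc k n = ≡.trans (distribute k n (n C 2)) (≡.cong (k ℕ.* suc n ℕ.+_) (≡.sym (suc-C-2 n)))
  where
  open import Data.Nat.Tactic.RingSolver using (solve-∀)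
  distribute : ∀ k n c → k ℕ.+ (suc k ℕ.* n ℕ.+ c) ≡ k ℕ.* suc n ℕ.+ (n ℕ.+ c)
  distribute = solve-∀

module Entries {c ℓ} (A : QAlgebra c ℓ) where
  open QAlgebra A hiding (zero)
  open import Algebra.Properties.Ring ring using (-0#≈0#)
  open import Relation.Binary.Reasoning.Setoid setoid
  open IntegerCoefficients cring using (solve; _:+_; _:*_; _:-_; _:=_; con; ringℕ-+; ringℕ-*)

  falling-cong : ∀ {X Y} k → X ≈ Y → falling A X k ≈ falling A Y k
  falling-cong zero    X≈Y = refl
  falling-cong (suc k) X≈Y = *-cong (falling-cong k X≈Y) (+-congʳ X≈Y)

  binom-cong : ∀ {X Y} k → X ≈ Y → binom A X k ≈ binom A Y k
  binom-cong (+ k)    X≈Y = *-congʳ (falling-cong k X≈Y)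
  binom-cong -[1+ k ] X≈Y = refl

  falling-suc : ∀ Y k → falling A (Y + 1#) (suc k) ≈ (Y + 1#) * falling A Y k
  falling-suc Y zero    = solve 2 (λ y o → o :* ((y :+ o) :- con (+ 0)) := (y :+ o) :* o) refl Y 1#
  falling-suc Y (suc k) = begin
    falling A (Y + 1#) (suc k) * ((Y + 1#) - fromℕ (suc k))
      ≈⟨ *-congʳ (falling-suc Y k) ⟩
    (Y + 1#) * F * ((Y + 1#) - (1# + fromℕ k))
      ≈⟨ solve 4 (λ y o f k → (y :+ o) :* f :* ((y :+ o) :- (o :+ k)) := (y :+ o) :* (f :* (y :- k))) refl Y 1# F (fromℕ k) ⟩
    (Y + 1#) * falling A Y (suc k) ∎
    where F = falling A Y k

  binom-pascal : ∀ Y k → binom A (Y + 1#) k ≈ binom A Y k + binom A Y (k ℤ.- + 1)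
  binom-pascal Y -[1+ k ]    = sym (+-identityʳ 0#)
  binom-pascal Y (+ zero)    = sym (+-identityʳ _)
  binom-pascal Y (+ suc k)   = begin
    falling A (Y + 1#) (suc k) * (I * inv k)
      ≈⟨ *-congʳ (falling-suc Y k) ⟩
    (Y + 1#) * F * (I * inv k)
      ≈⟨ solve 6 (λ y o f i v k → (y :+ o) :* f :* (i :* v) := f :* (y :- k) :* (i :* v) :+ f :* i :* ((o :+ k) :* v))
                 refl Y 1# F I (inv k) (fromℕ k) ⟩
    F * (Y - fromℕ k) * (I * inv k) + F * I * (fromℕ (suc k) * inv k)
      ≈⟨ +-congˡ (trans (*-congˡ (inv-correct k)) (*-identityʳ _)) ⟩
    F * (Y - fromℕ k) * (I * inv k) + F * I ∎
    where F = falling A Y k; I = invFact A k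

  ballot : Carrier → ℤ → Carrier
  ballot X k = binom A X k - binom A X (k ℤ.- + 1)

  ballot-cong : ∀ {X Y} k → X ≈ Y → ballot X k ≈ ballot Y k
  ballot-cong k X≈Y = +-cong (binom-cong k X≈Y) (-‿cong (binom-cong (k ℤ.- + 1) X≈Y))

  ballot-pascal : ∀ Y k → ballot (Y + 1#) k ≈ ballot Y k + ballot Y (k ℤ.- + 1)
  ballot-pascal Y k = trans (+-cong (binom-pascal Y k) (-‿cong (binom-pascal Y (k ℤ.- + 1))))
    (solve 3 (λ b b′ b″ → (b :+ b′) :- (b′ :+ b″) := (b :- b′) :+ (b′ :- b″)) refl _ _ _)

  -- reducedEntry k (a + 2j) i is the (i, j) entry after k rounds of "difference the columns,
  -- then drop the first row and column"; round 0 is the matrix of the theorem.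
  reducedEntry : ℕ → Carrier → ℕ → Carrier
  reducedEntry zero    N i = ballot (N + fromℕ (2 ℕ.* i)) (+ i)
  reducedEntry (suc k) N i = reducedEntry k (N + fromℕ 3) i + reducedEntry k (N + fromℕ 2) i

  reducedEntry-cong : ∀ k {N N′} i → N ≈ N′ → reducedEntry k N i ≈ reducedEntry k N′ i
  reducedEntry-cong zero    i N≈N′ = ballot-cong (+ i) (+-congʳ N≈N′)
  reducedEntry-cong (suc k) i N≈N′ =
    +-cong (reducedEntry-cong k i (+-congʳ N≈N′)) (reducedEntry-cong k i (+-congʳ N≈N′))

  reducedEntry-zero : ∀ k N → reducedEntry k N 0 ≈ fromℕ (2 ^ k)
  reducedEntry-zero zero    N = +-cong (*-identityʳ 1#) -0#≈0#
  reducedEntry-zero (suc k) N = begin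
    reducedEntry k (N + fromℕ 3) 0 + reducedEntry k (N + fromℕ 2) 0
      ≈⟨ +-cong (reducedEntry-zero k _) (reducedEntry-zero k _) ⟩
    fromℕ (2 ^ k) + fromℕ (2 ^ k)
      ≈⟨ +-congˡ (reflexive (≡.cong fromℕ (≡.sym (ℕP.+-identityʳ (2 ^ k))))) ⟩
    fromℕ (2 ^ k) + fromℕ (2 ^ k ℕ.+ 0)
      ≈⟨ ringℕ-+ (2 ^ k) _ ⟨
    fromℕ (2 ^ suc k) ∎

  fromℕ-2*suc : ∀ i → fromℕ (2 ℕ.* suc i) ≈ fromℕ 2 + fromℕ (2 ℕ.* i)
  fromℕ-2*suc i = trans (reflexive (≡.cong fromℕ (ℕP.*-suc 2 i))) (ringℕ-+ 2 (2 ℕ.* i))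

  reducedEntry-zero-difference : ∀ M i →
    reducedEntry 0 (M + fromℕ 1) (suc i) - reducedEntry 0 M (suc i) ≈ reducedEntry 0 (M + fromℕ 2) i
  reducedEntry-zero-difference M i = begin
    ballot ((M + fromℕ 1) + fromℕ (2 ℕ.* suc i)) (+ suc i) - ballot (M + fromℕ (2 ℕ.* suc i)) (+ suc i)
      ≈⟨ +-cong (ballot-cong (+ suc i) shifted) (-‿cong (ballot-cong (+ suc i) unshifted)) ⟩
    ballot (Y + 1#) (+ suc i) - ballot Y (+ suc i)
      ≈⟨ +-congʳ (ballot-pascal Y (+ suc i)) ⟩
    (ballot Y (+ suc i) + ballot Y (+ i)) - ballot Y (+ suc i)
      ≈⟨ solve 2 (λ b b′ → (b :+ b′) :- b := b′) refl _ _ ⟩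
    ballot Y (+ i) ∎
    where
    T = fromℕ (2 ℕ.* i)
    Y = (M + fromℕ 2) + T
    shifted : (M + fromℕ 1) + fromℕ (2 ℕ.* suc i) ≈ Y + 1#
    shifted = trans (+-congˡ (fromℕ-2*suc i))
      (solve 3 (λ m t o → (m :+ (o :+ con (+ 0))) :+ (con (+ 2) :+ t) := ((m :+ con (+ 2)) :+ t) :+ o) refl M T 1#)
    unshifted : M + fromℕ (2 ℕ.* suc i) ≈ Y
    unshifted = trans (+-congˡ (fromℕ-2*suc i)) (sym (+-assoc _ _ _))

  reducedEntry-difference : ∀ k N i →
    reducedEntry k (N + fromℕ 2) (suc i) - reducedEntry k N (suc i) ≈ reducedEntry (suc k) N i
  reducedEntry-difference zero N i = begin
    E (N + fromℕ 2) (suc i) - E N (suc i)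
      ≈⟨ solve 3 (λ x y z → x :- z := (x :- y) :+ (y :- z)) refl _ (E (N + fromℕ 1) (suc i)) _ ⟩
    (E (N + fromℕ 2) (suc i) - E (N + fromℕ 1) (suc i)) + (E (N + fromℕ 1) (suc i) - E N (suc i))
      ≈⟨ +-congʳ (+-congʳ (reducedEntry-cong 0 (suc i)
           (solve 1 (λ n → n :+ con (+ 2) := (n :+ con (+ 1)) :+ con (+ 1)) refl N))) ⟩
    (E ((N + fromℕ 1) + fromℕ 1) (suc i) - E (N + fromℕ 1) (suc i)) + (E (N + fromℕ 1) (suc i) - E N (suc i))
      ≈⟨ +-cong (reducedEntry-zero-difference (N + fromℕ 1) i) (reducedEntry-zero-difference N i) ⟩
    E ((N + fromℕ 1) + fromℕ 2) i + E (N + fromℕ 2) i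
      ≈⟨ +-congʳ (reducedEntry-cong 0 i (solve 1 (λ n → (n :+ con (+ 1)) :+ con (+ 2) := n :+ con (+ 3)) refl N)) ⟩
    E (N + fromℕ 3) i + E (N + fromℕ 2) i ∎
    where E = reducedEntry 0
  reducedEntry-difference (suc k) N i = begin
    (E (N + fromℕ 2 + fromℕ 3) (suc i) + E (N + fromℕ 2 + fromℕ 2) (suc i))
      - (E (N + fromℕ 3) (suc i) + E (N + fromℕ 2) (suc i))
      ≈⟨ solve 4 (λ a b c d → (a :+ b) :- (c :+ d) := (a :- c) :+ (b :- d)) refl _ _ _ _ ⟩
    (E (N + fromℕ 2 + fromℕ 3) (suc i) - E (N + fromℕ 3) (suc i))
      + (E (N + fromℕ 2 + fromℕ 2) (suc i) - E (N + fromℕ 2) (suc i))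
      ≈⟨ +-congʳ (+-congʳ (reducedEntry-cong k (suc i)
           (solve 1 (λ n → n :+ con (+ 2) :+ con (+ 3) := n :+ con (+ 3) :+ con (+ 2)) refl N))) ⟩
    (E (N + fromℕ 3 + fromℕ 2) (suc i) - E (N + fromℕ 3) (suc i))
      + (E (N + fromℕ 2 + fromℕ 2) (suc i) - E (N + fromℕ 2) (suc i))
      ≈⟨ +-cong (reducedEntry-difference k (N + fromℕ 3) i) (reducedEntry-difference k (N + fromℕ 2) i) ⟩
    reducedEntry (suc k) (N + fromℕ 3) i + reducedEntry (suc k) (N + fromℕ 2) i ∎
    where E = reducedEntry k

  entry≈reducedEntry : ∀ a i j → entry A a i j ≈ reducedEntry 0 (a + fromℕ (2 ℕ.* j)) i
  entry≈reducedEntry a i j = ballot-cong (+ i) (trans (+-congʳ (ringℕ-+ (2 ℕ.* i) (2 ℕ.* j)))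
    (solve 3 (λ x y a → (x :+ y) :+ a := (a :+ y) :+ x) refl (fromℕ (2 ℕ.* i)) (fromℕ (2 ℕ.* j)) a))

  open Determinants A using (det-cong; det-constantFirstRow; matrixOf)

  det-reducedEntries : ∀ a n k →
    det A n (matrixOf n (λ i j → reducedEntry k (a + fromℕ (2 ℕ.* j)) i)) ≈ fromℕ (2 ^ (k ℕ.* n ℕ.+ n C 2))
  det-reducedEntries a zero    k rewrite ℕP.*-zeroʳ k = sym (+-identityʳ 1#)
  det-reducedEntries a (suc n) k = begin
    det A (suc n) (matrixOf (suc n) (λ i j → reducedEntry k (a + fromℕ (2 ℕ.* j)) i))
      ≈⟨ det-constantFirstRow n (λ i j → reducedEntry k (a + fromℕ (2 ℕ.* j)) i) (fromℕ (2 ^ k))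
                              (λ j → reducedEntry-zero k _) ⟩
    fromℕ (2 ^ k) * det A n (matrixOf n (λ i j →
      reducedEntry k (a + fromℕ (2 ℕ.* suc j)) (suc i) - reducedEntry k (a + fromℕ (2 ℕ.* j)) (suc i)))
      ≈⟨ *-congˡ (det-cong n (λ i j → trans (+-congʳ (reducedEntry-cong k _ (column-shift (toℕ j))))
                                            (reducedEntry-difference k _ _))) ⟩
    fromℕ (2 ^ k) * det A n (matrixOf n (λ i j → reducedEntry (suc k) (a + fromℕ (2 ℕ.* j)) i))
      ≈⟨ *-congˡ (det-reducedEntries a n (suc k)) ⟩
    fromℕ (2 ^ k) * fromℕ (2 ^ (suc k ℕ.* n ℕ.+ n C 2))
      ≈⟨ ringℕ-* (2 ^ k) _ ⟨
    fromℕ (2 ^ k ℕ.* 2 ^ (suc k ℕ.* n ℕ.+ n C 2))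
      ≡⟨ ≡.cong fromℕ (≡.trans (≡.sym (ℕP.^-distribˡ-+-* 2 k _)) (≡.cong (2 ^_) (exponent-suc k n))) ⟩
    fromℕ (2 ^ (k ℕ.* suc n ℕ.+ suc n C 2)) ∎
    where
    column-shift : ∀ j → a + fromℕ (2 ℕ.* suc j) ≈ (a + fromℕ (2 ℕ.* j)) + fromℕ 2
    column-shift j = trans (+-congˡ (trans (fromℕ-2*suc j) (+-comm _ _))) (sym (+-assoc _ _ _))

theorem4 : ∀ {c ℓ} (A : QAlgebra c ℓ) (a : QAlgebra.Carrier A) (n : ℕ) → 1 ≤ n →
    QAlgebra._≈_ A
    (det A n (λ i j → entry A a (toℕ i) (toℕ j)))
    (QAlgebra.fromℕ A (2 ^ (n C 2)))
theorem4 A a n _ = trans (det-cong n (λ i j → entry≈reducedEntry a (toℕ i) (toℕ j))) (det-reducedEntries a n 0)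
  where
  open QAlgebra A
  open Determinants A using (det-cong)
  open Entries A using (entry≈reducedEntry; det-reducedEntries)
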